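{- Let $\mathbf{A}$ be a complete BL-algebra, $W$ a non-empty set and $\pi:W\to A$ a map with $\sup_{w\in W}\pi(w)=1$. Then $\sup_{w\in W}\{\pi(w)\ast\pi(w)\}=1$.
   Context: A BL-algebra is an algebra $\langle A,\wedge,\vee,\ast,\to,0,1\rangle$ such that $\langle A,\wedge,\vee,0,1\rangle$ is a bounded lattice (order $\le$), $\langle A,\ast,1\rangle$ is a commutative monoid, $a\ast b\le c$ iff $a\le b\to c$, and $a\wedge b=a\ast(a\to b)$ and $(a\to b)\vee(b\to a)=1$ hold. It is complete if every subset has a supremum and an infimum. -}

module Defs where

open import Level using (Level; suc; _⊔_)
open import Relation.Binary.PropositionalEquality using (_≡_)
open import Data.Product using (_×_)

record BLAlgebra (a : Level) : Set (suc a) where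
  infixr 7 _∗_
  infixr 6 _∧_
  infixr 5 _∨_
  infixr 4 _⇒_
  infix  3 _≤_
  field
    Carrier : Set a
    _∧_ _∨_ _∗_ _⇒_ : Carrier → Carrier → Carrier
    𝟘 𝟙 : Carrier

  _≤_ : Carrier → Carrier → Set a
  x ≤ y = x ∧ y ≡ x

  field
    ∧-comm   : ∀ x y → x ∧ y ≡ y ∧ x
    ∧-assoc  : ∀ x y z → (x ∧ y) ∧ z ≡ x ∧ (y ∧ z)
    ∨-comm   : ∀ x y → x ∨ y ≡ y ∨ x
    ∨-assoc  : ∀ x y z → (x ∨ y) ∨ z ≡ x ∨ (y ∨ z)
    ∧-absorb : ∀ x y → x ∧ (x ∨ y) ≡ x
    ∨-absorb : ∀ x y → x ∨ (x ∧ y) ≡ x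
    𝟘-least  : ∀ x → 𝟘 ≤ x
    𝟙-greatest : ∀ x → x ≤ 𝟙
    ∗-comm   : ∀ x y → x ∗ y ≡ y ∗ x
    ∗-assoc  : ∀ x y z → (x ∗ y) ∗ z ≡ x ∗ (y ∗ z)
    ∗-identityʳ : ∀ x → x ∗ 𝟙 ≡ x
    residuated : ∀ x y z → (x ∗ y ≤ z → x ≤ y ⇒ z) × (x ≤ y ⇒ z → x ∗ y ≤ z)
    divisibility : ∀ x y → x ∧ y ≡ x ∗ (x ⇒ y)
    prelinearity : ∀ x y → (x ⇒ y) ∨ (y ⇒ x) ≡ 𝟙

module _ {a : Level} (A : BLAlgebra a) where
  open BLAlgebra A

  IsSupremum : {p : Level} → (Carrier → Set p) → Carrier → Set (a ⊔ p)
  IsSupremum P s = (∀ x → P x → x ≤ s) × (∀ u → (∀ x → P x → x ≤ u) → s ≤ u)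

  IsInfimum : {p : Level} → (Carrier → Set p) → Carrier → Set (a ⊔ p)
  IsInfimum P s = (∀ x → P x → s ≤ x) × (∀ u → (∀ x → P x → u ≤ x) → u ≤ s)

record IsComplete {a : Level} (A : BLAlgebra a) : Set (suc a) where
  open BLAlgebra A
  field
    sup : (Carrier → Set a) → Carrier
    sup-isSup : ∀ P → IsSupremum A P (sup P)
    inf : (Carrier → Set a) → Carrier
    inf-isInf : ∀ P → IsInfimum A P (inf P)

-- In a BL-algebra, prelinearity and divisibility give x ∗ y ≤ u as soon as
-- x ∗ x ≤ u and y ∗ y ≤ u. So if u bounds every square π w ∗ π w, then for a
-- fixed v it bounds every π w ∗ π v; residuating, v ⇒ u bounds every π w, hence
-- equals 𝟙 and π v ≤ u. Thus u bounds the π w and u = 𝟙.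
module Submission where

open import Defs
open import Level using (Level)
open import Data.Product using (Σ; _,_; proj₁; proj₂)
open import Relation.Binary.PropositionalEquality
  using (_≡_; refl; sym; trans; cong; subst; module ≡-Reasoning)

module BLProperties {a : Level} (A : BLAlgebra a) where
  open BLAlgebra A

  ≤-refl : ∀ x → x ≤ x
  ≤-refl x = trans (cong (x ∧_) (sym (∨-absorb x x))) (∧-absorb x (x ∧ x))

  ≤-trans : ∀ {x y z} → x ≤ y → y ≤ z → x ≤ z
  ≤-trans {x} {y} {z} x≤y y≤z = begin
    x ∧ z        ≡⟨ cong (_∧ z) (sym x≤y) ⟩
    (x ∧ y) ∧ z  ≡⟨ ∧-assoc x y z ⟩
    x ∧ (y ∧ z)  ≡⟨ cong (x ∧_) y≤z ⟩
    x ∧ y        ≡⟨ x≤y ⟩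
    x            ∎
    where open ≡-Reasoning

  ≤-respˡ-≡ : ∀ {x y z} → x ≡ y → y ≤ z → x ≤ z
  ≤-respˡ-≡ refl y≤z = y≤z

  x∧y≤y : ∀ x y → x ∧ y ≤ y
  x∧y≤y x y = trans (∧-assoc x y y) (cong (x ∧_) (≤-refl y))

  ≤⇒∨≡ : ∀ {x y} → x ≤ y → x ∨ y ≡ y
  ≤⇒∨≡ {x} {y} x≤y = begin
    x ∨ y        ≡⟨ cong (_∨ y) (sym x≤y) ⟩
    (x ∧ y) ∨ y  ≡⟨ ∨-comm (x ∧ y) y ⟩
    y ∨ (x ∧ y)  ≡⟨ cong (y ∨_) (∧-comm x y) ⟩
    y ∨ (y ∧ x)  ≡⟨ ∨-absorb y x ⟩
    y            ∎
    where open ≡-Reasoning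

  ∨≡⇒≤ : ∀ {x y} → x ∨ y ≡ y → x ≤ y
  ∨≡⇒≤ {x} {y} x∨y≡y = trans (cong (x ∧_) (sym x∨y≡y)) (∧-absorb x y)

  ∨-least : ∀ {x y u} → x ≤ u → y ≤ u → x ∨ y ≤ u
  ∨-least {x} {y} {u} x≤u y≤u = ∨≡⇒≤
    (trans (∨-assoc x y u) (trans (cong (x ∨_) (≤⇒∨≡ y≤u)) (≤⇒∨≡ x≤u)))

  ∗-≤⇒≤-⇒ : ∀ {x y z} → x ∗ y ≤ z → x ≤ y ⇒ z
  ∗-≤⇒≤-⇒ {x} {y} {z} = proj₁ (residuated x y z)

  ≤-⇒⇒∗-≤ : ∀ {x y z} → x ≤ y ⇒ z → x ∗ y ≤ z
  ≤-⇒⇒∗-≤ {x} {y} {z} = proj₂ (residuated x y z)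

  ∗-identityˡ : ∀ x → 𝟙 ∗ x ≡ x
  ∗-identityˡ x = trans (∗-comm 𝟙 x) (∗-identityʳ x)

  ∗-monoˡ-≤ : ∀ {x y} z → x ≤ y → x ∗ z ≤ y ∗ z
  ∗-monoˡ-≤ {x} {y} z x≤y = ≤-⇒⇒∗-≤ (≤-trans x≤y (∗-≤⇒≤-⇒ (≤-refl (y ∗ z))))

  ∗-distribʳ-∨-≤ : ∀ {x y z u} → x ∗ z ≤ u → y ∗ z ≤ u → (x ∨ y) ∗ z ≤ u
  ∗-distribʳ-∨-≤ xz≤u yz≤u = ≤-⇒⇒∗-≤ (∨-least (∗-≤⇒≤-⇒ xz≤u) (∗-≤⇒≤-⇒ yz≤u))

  ⇒-∗-∗≡∧-∗ : ∀ x y → (x ⇒ y) ∗ (x ∗ y) ≡ (x ∧ y) ∗ y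
  ⇒-∗-∗≡∧-∗ x y = begin
    (x ⇒ y) ∗ (x ∗ y)  ≡⟨ sym (∗-assoc (x ⇒ y) x y) ⟩
    ((x ⇒ y) ∗ x) ∗ y  ≡⟨ cong (_∗ y) (∗-comm (x ⇒ y) x) ⟩
    (x ∗ (x ⇒ y)) ∗ y  ≡⟨ cong (_∗ y) (sym (divisibility x y)) ⟩
    (x ∧ y) ∗ y        ∎
    where open ≡-Reasoning

  ⇒-∗-∗-≤ : ∀ {x y u} → y ∗ y ≤ u → (x ⇒ y) ∗ (x ∗ y) ≤ u
  ⇒-∗-∗-≤ {x} {y} yy≤u =
    ≤-respˡ-≡ (⇒-∗-∗≡∧-∗ x y) (≤-trans (∗-monoˡ-≤ y (x∧y≤y x y)) yy≤u)

  -- Split 𝟙 = (x ⇒ y) ∨ (y ⇒ x) and bound each half by one of the squares.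
  ∗-≤-by-squares : ∀ {x y u} → x ∗ x ≤ u → y ∗ y ≤ u → x ∗ y ≤ u
  ∗-≤-by-squares {x} {y} {u} xx≤u yy≤u =
    ≤-respˡ-≡ (sym (∗-identityˡ (x ∗ y)))
      (subst (λ t → t ∗ (x ∗ y) ≤ u) (prelinearity x y)
        (∗-distribʳ-∨-≤ (⇒-∗-∗-≤ yy≤u)
          (subst (λ t → (y ⇒ x) ∗ t ≤ u) (∗-comm y x) (⇒-∗-∗-≤ xx≤u))))

  ≤-of-∗-bounds-on-sup𝟙 : ∀ {p} {S : Carrier → Set p} {x u} →
    IsSupremum A S 𝟙 → (∀ s → S s → s ∗ x ≤ u) → x ≤ u
  ≤-of-∗-bounds-on-sup𝟙 {x = x} (_ , least) sx≤u =
    ≤-respˡ-≡ (sym (∗-identityˡ x))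
      (≤-⇒⇒∗-≤ (least _ (λ s s∈S → ∗-≤⇒≤-⇒ (sx≤u s s∈S))))

lemma3 : {a : Level} (A : BLAlgebra a) → IsComplete A →
    (W : Set a) → W → (π : W → BLAlgebra.Carrier A) →
    IsSupremum A (λ x → Σ W (λ w → π w ≡ x)) (BLAlgebra.𝟙 A) →
    IsSupremum A (λ x → Σ W (λ w → BLAlgebra._∗_ A (π w) (π w) ≡ x)) (BLAlgebra.𝟙 A)
lemma3 A _ W _ π sup-π≡𝟙 = (λ x _ → 𝟙-greatest x) , least
  where
  open BLAlgebra A
  open BLProperties A

  least : ∀ u → (∀ x → Σ W (λ w → π w ∗ π w ≡ x) → x ≤ u) → 𝟙 ≤ u
  least u bounds-squares = proj₂ sup-π≡𝟙 u π-≤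
    where
    square-≤ : ∀ w → π w ∗ π w ≤ u
    square-≤ w = bounds-squares _ (w , refl)

    π-≤ : ∀ x → Σ W (λ w → π w ≡ x) → x ≤ u
    π-≤ _ (v , refl) = ≤-of-∗-bounds-on-sup𝟙 sup-π≡𝟙
      (λ { _ (w , refl) → ∗-≤-by-squares (square-≤ w) (square-≤ v) })
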